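{- No triangular partition has more than $2$ removable cells. Similarly, no triangular partition has more than $2$ addable cells.
   Context: Partitions are identified with their diagrams: cells $(i,j)\in\mathbb{N}^2$ ($i$ column, $j$ row, starting at $0$). For positive reals $r,s$, $\tau_{rs}=\{(i,j)\in\mathbb{N}^2 : \frac{i+1}{r}+\frac{j+1}{s}\le 1\}$; a partition is triangular if it equals $\tau_{rs}$ for some positive reals $r,s$. A cell of a triangular partition $\tau$ is removable if removing it yields a triangular partition; a cell of $\mathbb{N}^2\setminus\tau$ is addable if adding it to $\tau$ yields a triangular partition.
   Formalization: The parameters r and s defining triangular partitions, and hence removable and addable cells, range over the positive rationals rather than the positive reals. -}

module Defs where

open import Data.Nat using (ℕ; suc)
open import Data.Integer using (+_)
open import Data.Rational using (ℚ; 0ℚ; 1ℚ; _+_; _÷_; _≤_; _<_; _/_; positive)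
open import Data.Rational.Properties using (pos⇒nonZero)
open import Data.Product using (_×_; _,_; Σ; ∃)
open import Data.Sum using (_⊎_)
open import Relation.Binary.PropositionalEquality using (_≡_; _≢_)
open import Function.Bundles using (_⇔_)
open import Level using (0ℓ)

-- A cell (i , j) : i = column, j = row, both starting at 0.
Cell : Set
Cell = ℕ × ℕ

Diagram : Set₁
Diagram = Cell → Set

ℕ→ℚ : ℕ → ℚ
ℕ→ℚ n = (+ n) / 1

τ : (r s : ℚ) → 0ℚ < r → 0ℚ < s → Diagram
τ r s r>0 s>0 (i , j) =
  _≤_ ((_÷_ (ℕ→ℚ (suc i)) r {{pos⇒nonZero r {{positive r>0}}}})
       + (_÷_ (ℕ→ℚ (suc j)) s {{pos⇒nonZero s {{positive s>0}}}}))
      1ℚ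

_≐_ : Diagram → Diagram → Set
D ≐ E = ∀ c → D c ⇔ E c

Triangular : Diagram → Set
Triangular D = Σ ℚ λ r → Σ ℚ λ s → Σ (0ℚ < r) λ r>0 → Σ (0ℚ < s) λ s>0 →
  D ≐ τ r s r>0 s>0

remove : Diagram → Cell → Diagram
remove D c d = D d × d ≢ c

add : Diagram → Cell → Diagram
add D c d = D d ⊎ d ≡ c

Removable : Diagram → Cell → Set
Removable D c = D c × Triangular (remove D c)

Addable : Diagram → Cell → Set
Addable D c = (D c → Data.Empty.⊥) × Triangular (add D c)
  where import Data.Empty

-- A triangular diagram is the set of cells on one side of a line with nonnegative normal,
-- so it is balanced: if a + b ≤ c + d componentwise, then c, d ∈ D and a, b ∉ D cannot
-- both hold.  For a removable (addable) cell p this applies to D ∖ {p} (D ∪ {p}).  Two such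
-- cells q ≠ p never satisfy q ≤ 2p: the reflected cell 2p − q is in D or not, and either
-- way one of the two modified diagrams is unbalanced.  So these cells form an antichain and
-- have distinct columns.  For three of them a, m, b in increasing column order, unless a or
-- b lies below 2m or m ≤ b, the cell b is right of 2m and a is above it; then 2m ≤ a + b
-- contradicts balancedness of D ∖ {m} (for addable cells, 2m ≤ a + b′ in D ∪ {a}, where
-- b′ ∈ D is the left neighbour of b).
module Submission where

open import Defs
open import Data.Product using (_×_)
open import Data.Sum using (_⊎_)
open import Relation.Binary.PropositionalEquality using (_≡_)

open import Data.Empty using (⊥; ⊥-elim)
open import Data.Integer as ℤ using (+_)
import Data.Integer.Properties as ℤ
open import Data.Nat as ℕ using (suc; s≤s)
import Data.Nat.Properties as ℕ
open import Algebra.Properties.CommutativeSemigroup ℕ.+-commutativeSemigroup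
  using (interchange)
open import Data.Nat.Coprimality using (1-coprimeTo) renaming (sym to coprime-sym)
open import Data.Product using (_,_; proj₁; proj₂; ∃)
open import Data.Product.Properties using (×-≡,≡→≡)
open import Data.Rational as ℚ using (ℚ; mkℚ; 0ℚ; 1ℚ; _/_; 1/_; NonNegative)
import Data.Rational.Properties as ℚ
open import Data.Rational.Solver using (module +-*-Solver)
open import Data.Sum using (inj₁; inj₂; [_,_]; map; swap)
open import Function using (_∘_)
open import Function.Bundles using (Equivalence)
open import Relation.Binary.Definitions using (tri<; tri≈; tri>)
open import Relation.Binary.PropositionalEquality using (_≢_; ≢-sym; refl; sym; cong; cong₂; module ≡-Reasoning)
open import Relation.Nullary using (¬_; yes; no)
open import Relation.Nullary.Decidable using (¬¬-excluded-middle)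

private
  variable
    a b c d p q m : Cell
    D E : Diagram

infixl 6 _⊕_
infix  4 _≼_

_⊕_ : Cell → Cell → Cell
(i , j) ⊕ (k , l) = i ℕ.+ k , j ℕ.+ l

_≼_ : Cell → Cell → Set
(i , j) ≼ (k , l) = i ℕ.≤ k × j ℕ.≤ l

≼-reflexive : a ≡ b → a ≼ b
≼-reflexive refl = ℕ.≤-refl , ℕ.≤-refl

≼⇒∃⊕ : a ≼ b → ∃ λ x → a ⊕ x ≡ b
≼⇒∃⊕ (i≤k , j≤l) with ℕ.m≤n⇒∃[o]m+o≡n i≤k | ℕ.m≤n⇒∃[o]m+o≡n j≤l
... | x , i+x≡k | y , j+y≡l = (x , y) , cong₂ _,_ i+x≡k j+y≡l

⊕-cancelʳ : a ⊕ c ≡ b ⊕ c → a ≡ b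
⊕-cancelʳ {c = k , l} eq =
  ×-≡,≡→≡ (ℕ.+-cancelʳ-≡ k _ _ (cong proj₁ eq) , ℕ.+-cancelʳ-≡ l _ _ (cong proj₂ eq))

⊕-shift-≼ : ∀ e → a ⊕ b ≼ c ⊕ d → (e ⊕ a) ⊕ (e ⊕ b) ≼ (e ⊕ c) ⊕ (e ⊕ d)
⊕-shift-≼ (e₁ , e₂) (h₁ , h₂) = shift e₁ h₁ , shift e₂ h₂
  where
  open ℕ.≤-Reasoning
  shift : ∀ x {i j k l} → i ℕ.+ j ℕ.≤ k ℕ.+ l →
          (x ℕ.+ i) ℕ.+ (x ℕ.+ j) ℕ.≤ (x ℕ.+ k) ℕ.+ (x ℕ.+ l)
  shift x {i} {j} {k} {l} h = begin
    (x ℕ.+ i) ℕ.+ (x ℕ.+ j) ≡⟨ interchange x i x j ⟩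
    (x ℕ.+ x) ℕ.+ (i ℕ.+ j) ≤⟨ ℕ.+-monoʳ-≤ (x ℕ.+ x) h ⟩
    (x ℕ.+ x) ℕ.+ (k ℕ.+ l) ≡⟨ interchange x x k l ⟩
    (x ℕ.+ k) ℕ.+ (x ℕ.+ l) ∎

Balanced : Diagram → Set
Balanced E = ∀ {a b c d} → a ⊕ b ≼ c ⊕ d → ¬ E a → ¬ E b → E c → ¬ E d

Balanced-resp-≐ : D ≐ E → Balanced E → Balanced D
Balanced-resp-≐ D≐E balanced {a} {b} {c} {d} ab≼cd a∉ b∉ c∈ d∈ =
  balanced {a} {b} {c} {d} ab≼cd (a∉ ∘ from) (b∉ ∘ from) (to c∈) (to d∈)
  where open module D≐E {x} = Equivalence (D≐E x)

ℕ→ℚ≡mkℚ : ∀ n → ℕ→ℚ n ≡ mkℚ (+ n) 0 (coprime-sym (1-coprimeTo n))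
ℕ→ℚ≡mkℚ n = ℚ.normalize-coprime (coprime-sym (1-coprimeTo n))

ℕ→ℚ-+ : ∀ m n → ℕ→ℚ (m ℕ.+ n) ≡ ℕ→ℚ m ℚ.+ ℕ→ℚ n
ℕ→ℚ-+ m n = begin
  + (m ℕ.+ n) / 1
    ≡⟨ cong (_/ 1) (cong₂ ℤ._+_ (ℤ.*-identityʳ (+ m)) (ℤ.*-identityʳ (+ n))) ⟨
  (+ m ℤ.* + 1 ℤ.+ + n ℤ.* + 1) / 1
    ≡⟨ cong₂ ℚ._+_ (ℕ→ℚ≡mkℚ m) (ℕ→ℚ≡mkℚ n) ⟨
  ℕ→ℚ m ℚ.+ ℕ→ℚ n ∎
  where open ≡-Reasoning

weight : ℚ → ℚ → Cell → ℚ
weight u v (i , j) = ℕ→ℚ i ℚ.* u ℚ.+ ℕ→ℚ j ℚ.* v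

weight-⊕ : ∀ u v a b → weight u v (a ⊕ b) ≡ weight u v a ℚ.+ weight u v b
weight-⊕ u v (i , j) (k , l) = begin
  ℕ→ℚ (i ℕ.+ k) ℚ.* u ℚ.+ ℕ→ℚ (j ℕ.+ l) ℚ.* v
    ≡⟨ cong₂ (λ x y → x ℚ.* u ℚ.+ y ℚ.* v) (ℕ→ℚ-+ i k) (ℕ→ℚ-+ j l) ⟩
  (ℕ→ℚ i ℚ.+ ℕ→ℚ k) ℚ.* u ℚ.+ (ℕ→ℚ j ℚ.+ ℕ→ℚ l) ℚ.* v
    ≡⟨ distribute (ℕ→ℚ i) (ℕ→ℚ k) (ℕ→ℚ j) (ℕ→ℚ l) u v ⟩
  weight u v (i , j) ℚ.+ weight u v (k , l) ∎
  where
  open ≡-Reasoning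
  open +-*-Solver
  distribute : ∀ i k j l u v →
    (i ℚ.+ k) ℚ.* u ℚ.+ (j ℚ.+ l) ℚ.* v ≡ (i ℚ.* u ℚ.+ j ℚ.* v) ℚ.+ (k ℚ.* u ℚ.+ l ℚ.* v)
  distribute = solve 6 (λ i k j l u v →
    (i :+ k) :* u :+ (j :+ l) :* v := (i :* u :+ j :* v) :+ (k :* u :+ l :* v)) refl

module _ (u v : ℚ) .{{_ : NonNegative u}} .{{_ : NonNegative v}} where

  weight-nonNeg : ∀ c → 0ℚ ℚ.≤ weight u v c
  weight-nonNeg (i , j) = ℚ.nonNegative⁻¹ (weight u v (i , j))
    {{ℚ.nonNeg+nonNeg⇒nonNeg (ℕ→ℚ i ℚ.* u) {{term i u}} (ℕ→ℚ j ℚ.* v) {{term j v}}}}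
    where
    term : ∀ n w .{{_ : NonNegative w}} → NonNegative (ℕ→ℚ n ℚ.* w)
    term n w = ℚ.nonNeg*nonNeg⇒nonNeg (ℕ→ℚ n) {{ℚ.normalize-nonNeg n 1}} w

  weight-mono : a ≼ b → weight u v a ℚ.≤ weight u v b
  weight-mono {a} a≼b with ≼⇒∃⊕ a≼b
  ... | x , refl = begin
    weight u v a                          ≡⟨ ℚ.+-identityʳ (weight u v a) ⟨
    weight u v a ℚ.+ 0ℚ                   ≤⟨ ℚ.+-monoʳ-≤ (weight u v a) (weight-nonNeg x) ⟩
    weight u v a ℚ.+ weight u v x         ≡⟨ weight-⊕ u v a x ⟨
    weight u v (a ⊕ x)                    ∎
    where open ℚ.≤-Reasoning

  halfPlane-balanced : ∀ e t → Balanced (λ c → weight u v (e ⊕ c) ℚ.≤ t)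
  halfPlane-balanced e t {a} {b} {c} {d} ab≼cd a∉ b∉ c∈ d∈ = ℚ.<-irrefl refl (begin-strict
    t ℚ.+ t                                  <⟨ ℚ.+-mono-< (ℚ.≰⇒> a∉) (ℚ.≰⇒> b∉) ⟩
    weight u v (e ⊕ a) ℚ.+ weight u v (e ⊕ b) ≡⟨ weight-⊕ u v (e ⊕ a) (e ⊕ b) ⟨
    weight u v (e ⊕ a ⊕ (e ⊕ b))             ≤⟨ weight-mono (⊕-shift-≼ e ab≼cd) ⟩
    weight u v (e ⊕ c ⊕ (e ⊕ d))             ≡⟨ weight-⊕ u v (e ⊕ c) (e ⊕ d) ⟩
    weight u v (e ⊕ c) ℚ.+ weight u v (e ⊕ d) ≤⟨ ℚ.+-mono-≤ c∈ d∈ ⟩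
    t ℚ.+ t                                  ∎)
    where open ℚ.≤-Reasoning

-- τ r s c unfolds to weight (1/ r) (1/ s) ((1 , 1) ⊕ c) ≤ 1ℚ.
triangular⇒balanced : Triangular D → Balanced D
triangular⇒balanced (r , s , r>0 , s>0 , D≐τ) =
  Balanced-resp-≐ D≐τ
    (λ {a} {b} {c} {d} → halfPlane-balanced (1/ r) (1/ s) (1 , 1) 1ℚ {a} {b} {c} {d})
  where
  instance
    r-pos : ℚ.Positive r
    r-pos = ℚ.positive r>0
    s-pos : ℚ.Positive s
    s-pos = ℚ.positive s>0
    r-nonZero : ℚ.NonZero r
    r-nonZero = ℚ.pos⇒nonZero r
    s-nonZero : ℚ.NonZero s
    s-nonZero = ℚ.pos⇒nonZero s
    1/r-nonNeg : NonNegative (1/ r)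
    1/r-nonNeg = ℚ.pos⇒nonNeg (1/ r) {{ℚ.1/pos⇒pos r}}
    1/s-nonNeg : NonNegative (1/ s)
    1/s-nonNeg = ℚ.pos⇒nonNeg (1/ s) {{ℚ.1/pos⇒pos s}}

column-<⇒≢ : proj₁ p ℕ.< proj₁ q → p ≢ q
column-<⇒≢ p<q = ℕ.<⇒≢ p<q ∘ cong proj₁

row-<⇒≢ : proj₂ p ℕ.< proj₂ q → p ≢ q
row-<⇒≢ p<q = ℕ.<⇒≢ p<q ∘ cong proj₂

m+m<n⇒m<n : ∀ {m n} → m ℕ.+ m ℕ.< n → m ℕ.< n
m+m<n⇒m<n {m} = ℕ.≤-<-trans (ℕ.m≤m+n m m)

module Removal (D : Diagram) where

  removed : ¬ remove D p p
  removed (_ , p≢p) = p≢p refl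

  removable-reflect : Removable D p → Removable D q → q ≢ p → q ≼ p ⊕ p → ⊥
  removable-reflect {p} {q} (p∈ , D-p) (q∈ , D-q) q≢p q≼2p with ≼⇒∃⊕ q≼2p
  -- x = 2p − q.  The goal is ⊥, so deciding x ∈ D classically costs nothing.
  ... | x , q⊕x≡2p = ¬¬-excluded-middle λ
    { (yes x∈) → triangular⇒balanced D-p (≼-reflexive (sym q⊕x≡2p))
                   removed removed (q∈ , q≢p) (x∈ , x≢p)
    ; (no x∉)  → triangular⇒balanced D-q (≼-reflexive q⊕x≡2p)
                   removed (x∉ ∘ proj₁) (p∈ , q≢p ∘ sym) (p∈ , q≢p ∘ sym)
    }
    where
    x≢p : x ≢ p
    x≢p refl = q≢p (⊕-cancelʳ q⊕x≡2p)

  removable-spread : Removable D a → Removable D m → Removable D b →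
    proj₁ m ℕ.+ proj₁ m ℕ.< proj₁ b → proj₂ m ℕ.+ proj₂ m ℕ.< proj₂ a → ⊥
  removable-spread {a} {m} {b} (a∈ , _) (_ , D-m) (b∈ , _) 2m₁<b₁ 2m₂<a₂ =
    triangular⇒balanced D-m 2m≼a⊕b removed removed
      (a∈ , ≢-sym (row-<⇒≢ (m+m<n⇒m<n 2m₂<a₂)))
      (b∈ , ≢-sym (column-<⇒≢ (m+m<n⇒m<n 2m₁<b₁)))
    where
    2m≼a⊕b : m ⊕ m ≼ a ⊕ b
    2m≼a⊕b = ℕ.≤-trans (ℕ.<⇒≤ 2m₁<b₁) (ℕ.m≤n+m _ (proj₁ a))
           , ℕ.≤-trans (ℕ.<⇒≤ 2m₂<a₂) (ℕ.m≤m+n _ (proj₂ b))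

module Addition (D : Diagram) where

  outside : ¬ D c → c ≢ p → ¬ add D p c
  outside c∉ c≢p = [ c∉ , c≢p ]

  addable-reflect : Addable D p → Addable D q → q ≢ p → q ≼ p ⊕ p → ⊥
  addable-reflect {p} {q} (p∉ , D+p) (q∉ , D+q) q≢p q≼2p with ≼⇒∃⊕ q≼2p
  ... | x , q⊕x≡2p = ¬¬-excluded-middle λ
    { (yes x∈) → triangular⇒balanced D+q (≼-reflexive (sym q⊕x≡2p))
                   (outside p∉ (q≢p ∘ sym)) (outside p∉ (q≢p ∘ sym)) (inj₂ refl) (inj₁ x∈)
    ; (no x∉)  → triangular⇒balanced D+p (≼-reflexive q⊕x≡2p)
                   (outside q∉ q≢p) (outside x∉ x≢p) (inj₂ refl) (inj₂ refl)
    }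
    where
    x≢p : x ≢ p
    x≢p refl = q≢p (⊕-cancelʳ q⊕x≡2p)

  addable-left-neighbour-in : ∀ {i j} → Addable D (suc i , j) → ¬ ¬ D (i , j)
  addable-left-neighbour-in {i} {j} (_ , D+b) left∉ =
    triangular⇒balanced D+b (ℕ.+-mono-≤ (ℕ.n≤1+n i) (ℕ.n≤1+n i) , ℕ.≤-refl)
      (outside left∉ left≢b) (outside left∉ left≢b) (inj₂ refl) (inj₂ refl)
    where
    left≢b : (i , j) ≢ (suc i , j)
    left≢b = column-<⇒≢ (ℕ.n<1+n i)

  addable-spread : Addable D a → Addable D m → Addable D b →
    proj₁ m ℕ.+ proj₁ m ℕ.< proj₁ b → proj₂ m ℕ.+ proj₂ m ℕ.< proj₂ a → ⊥
  addable-spread {a} {m} {suc i , j} (_ , D+a) (m∉ , _) b-addable (s≤s 2m₁≤i) 2m₂<a₂ =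
    addable-left-neighbour-in b-addable λ left∈ →
      triangular⇒balanced D+a 2m≼a⊕left (outside m∉ m≢a) (outside m∉ m≢a) (inj₂ refl) (inj₁ left∈)
    where
    m≢a : m ≢ a
    m≢a = row-<⇒≢ (m+m<n⇒m<n 2m₂<a₂)
    2m≼a⊕left : m ⊕ m ≼ a ⊕ (i , j)
    2m≼a⊕left = ℕ.≤-trans 2m₁≤i (ℕ.m≤n+m i (proj₁ a))
              , ℕ.≤-trans (ℕ.<⇒≤ 2m₂<a₂) (ℕ.m≤m+n _ j)

module AtMostTwo (R : Cell → Set)
  (reflect : ∀ {p q} → R p → R q → q ≢ p → q ≼ p ⊕ p → ⊥)
  (spread : ∀ {a m b} → R a → R m → R b →
            proj₁ m ℕ.+ proj₁ m ℕ.< proj₁ b → proj₂ m ℕ.+ proj₂ m ℕ.< proj₂ a → ⊥)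
  where

  incomparable : R p → R q → p ≢ q → p ≼ q → ⊥
  incomparable rp rq p≢q (i≤ , j≤) =
    reflect rq rp p≢q (ℕ.≤-trans i≤ (ℕ.m≤m+n _ _) , ℕ.≤-trans j≤ (ℕ.m≤m+n _ _))

  column-injective : R p → R q → proj₁ p ≡ proj₁ q → p ≡ q
  column-injective {p} {q} rp rq i≡ with ℕ.<-cmp (proj₂ p) (proj₂ q)
  ... | tri< j< _ _ = ⊥-elim (incomparable rp rq (row-<⇒≢ j<) (ℕ.≤-reflexive i≡ , ℕ.<⇒≤ j<))
  ... | tri≈ _ j≡ _ = ×-≡,≡→≡ (i≡ , j≡)
  ... | tri> _ _ j> = ⊥-elim (incomparable rq rp (row-<⇒≢ j>) (ℕ.≤-reflexive (sym i≡) , ℕ.<⇒≤ j>))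

  no-increasing-triple : R a → R m → R b → proj₁ a ℕ.< proj₁ m → proj₁ m ℕ.< proj₁ b → ⊥
  no-increasing-triple {a} {m} {b} ra rm rb a<m m<b
    with proj₂ a ℕ.≤? proj₂ m ℕ.+ proj₂ m | proj₁ b ℕ.≤? proj₁ m ℕ.+ proj₁ m
       | proj₂ b ℕ.≤? proj₂ m ℕ.+ proj₂ m
  ... | yes a₂≤2m₂ | _ | _ =
    reflect rm ra (column-<⇒≢ a<m) (ℕ.≤-trans (ℕ.<⇒≤ a<m) (ℕ.m≤m+n _ _) , a₂≤2m₂)
  ... | no a₂≰2m₂ | no b₁≰2m₁ | _ = spread ra rm rb (ℕ.≰⇒> b₁≰2m₁) (ℕ.≰⇒> a₂≰2m₂)
  ... | no _ | yes b₁≤2m₁ | yes b₂≤2m₂ =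
    reflect rm rb (≢-sym (column-<⇒≢ m<b)) (b₁≤2m₁ , b₂≤2m₂)
  ... | no _ | yes _ | no b₂≰2m₂ =
    incomparable rm rb (column-<⇒≢ m<b)
      (ℕ.<⇒≤ m<b , ℕ.<⇒≤ (m+m<n⇒m<n (ℕ.≰⇒> b₂≰2m₂)))

  third-coincides : R a → R b → R c → proj₁ a ℕ.< proj₁ b → c ≡ a ⊎ c ≡ b
  third-coincides {a} {b} {c} ra rb rc a<b
    with ℕ.<-cmp (proj₁ c) (proj₁ a) | ℕ.<-cmp (proj₁ c) (proj₁ b)
  ... | tri≈ _ c≡a _ | _            = inj₁ (column-injective rc ra c≡a)
  ... | _            | tri≈ _ c≡b _ = inj₂ (column-injective rc rb c≡b)
  ... | tri< c<a _ _ | _            = ⊥-elim (no-increasing-triple rc ra rb c<a a<b)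
  ... | tri> _ _ a<c | tri< c<b _ _ = ⊥-elim (no-increasing-triple ra rc rb a<c c<b)
  ... | tri> _ _ _   | tri> _ _ b<c = ⊥-elim (no-increasing-triple ra rb rc a<b b<c)

  at-most-two : ∀ c₁ c₂ c₃ → R c₁ → R c₂ → R c₃ → c₁ ≡ c₂ ⊎ c₁ ≡ c₃ ⊎ c₂ ≡ c₃
  at-most-two c₁ c₂ c₃ r₁ r₂ r₃ with ℕ.<-cmp (proj₁ c₁) (proj₁ c₂)
  ... | tri< c₁<c₂ _ _ = inj₂ (map sym sym (third-coincides r₁ r₂ r₃ c₁<c₂))
  ... | tri≈ _ c₁≡c₂ _ = inj₁ (column-injective r₁ r₂ c₁≡c₂)
  ... | tri> _ _ c₂<c₁ = inj₂ (swap (map sym sym (third-coincides r₂ r₁ r₃ c₂<c₁)))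

mainTheorem8 : (D : Diagram) → Triangular D →
    (∀ c₁ c₂ c₃ → Removable D c₁ → Removable D c₂ → Removable D c₃ →
    c₁ ≡ c₂ ⊎ c₁ ≡ c₃ ⊎ c₂ ≡ c₃)
    ×
    (∀ c₁ c₂ c₃ → Addable D c₁ → Addable D c₂ → Addable D c₃ →
    c₁ ≡ c₂ ⊎ c₁ ≡ c₃ ⊎ c₂ ≡ c₃)
mainTheorem8 D _ =
  AtMostTwo.at-most-two (Removable D) removable-reflect removable-spread ,
  AtMostTwo.at-most-two (Addable D) addable-reflect addable-spread
  where
  open Removal D
  open Addition D
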